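{- Let $G=(V,E)$ be a finite simple graph with $m=|E|$, and let $\vec E$ be its set of $2m$ directed edges (each $\{u,v\}\in E$ gives $(u,v)$ and $(v,u)$). Let $T$ be the Hashimoto matrix on $\mathbb R^{\vec E}$, $T_{(u,v),(x,y)}=1$ if $v=x$ and $y\neq u$, and $0$ otherwise. Let $P$ be the permutation matrix of edge reversal, $Pe_{(u,v)}=e_{(v,u)}$. Let $A$ be the adjacency matrix of the graph $\mathrm{HL}'_2(G)$ whose vertex set is $\vec E$, in which two distinct directed edges are adjacent if and only if they share a tail or share a head. Then \[A=PT+TP,\] and consequently (using $P^2=I$ and $T=PT^\top P$) \[PA=T+T^\top.\]
   Context: For a directed edge $(u,v)$, $u$ is its tail and $v$ its head. -}

module Defs where

open import Data.Nat using (ℕ; _+_; _*_)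
open import Data.Bool using (Bool; true; false; T; T?; if_then_else_; _∧_; _∨_; not)
open import Data.Fin using (Fin; _≟_)
open import Data.List using (map; allFin)
open import Data.Nat.ListAction using (sum)
open import Relation.Binary.PropositionalEquality using (_≡_)
open import Relation.Nullary.Decidable using (Dec; yes; no; ⌊_⌋)

record SimpleGraph (n : ℕ) : Set where
  field
    adj       : Fin n → Fin n → Bool
    adj-sym   : ∀ u v → adj u v ≡ adj v u
    adj-irrefl : ∀ u → adj u u ≡ false

open SimpleGraph public

module _ {n : ℕ} (G : SimpleGraph n) where

  record DEdge : Set where
    constructor dedge
    field
      tail : Fin n
      head : Fin n
      isEdge : T (adj G tail head)

  open DEdge public

  sumDE : (DEdge → ℕ) → ℕ
  sumDE f = sum (map (λ u → sum (map (λ v → g u v (T? (adj G u v))) (allFin n))) (allFin n))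
    where
    g : (u v : Fin n) → Dec (T (adj G u v)) → ℕ
    g u v (yes p) = f (dedge u v p)
    g u v (no _)  = 0

  -- Matrices on ℝ^{E⃗} with (here 0/1, hence natural-number) entries.
  Mat : Set
  Mat = DEdge → DEdge → ℕ

  _⊗_ : Mat → Mat → Mat
  (M ⊗ N) e f = sumDE (λ c → M e c * N c f)

  _⊕_ : Mat → Mat → Mat
  (M ⊕ N) e f = M e f + N e f

  transpose : Mat → Mat
  transpose M e f = M f e

  private
    _==_ : Fin n → Fin n → Bool
    a == b = ⌊ a ≟ b ⌋

    ind : Bool → ℕ
    ind b = if b then 1 else 0

  hashimoto : Mat
  hashimoto e f = ind ((head e == tail f) ∧ not (head f == tail e))

  reversal : Mat
  reversal e f = ind ((tail e == head f) ∧ (head e == tail f))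

  hlAdj : Mat
  hlAdj e f = ind (not ((tail e == tail f) ∧ (head e == head f))
                   ∧ ((tail e == tail f) ∨ (head e == head f)))

{-# OPTIONS --safe #-}
module Submission where

-- Write e = (a , b) and f = (c , d).  Since P is the permutation matrix of
-- reversal, (PT + TP)_{e,f} = T_{(b,a),(c,d)} + T_{(a,b),(d,c)}
-- = [a = c ∧ b ≠ d] + [b = d ∧ a ≠ c], and the two summands are the two
-- disjoint ways for distinct directed edges to share a tail or a head.
-- Applying this to the reversal of e gives PA = T + Tᵀ, because reversing
-- both arguments of T transposes it.

open import Defs
open import Data.Nat using (ℕ; zero; suc; _+_; _*_)
open import Data.Nat.Properties using (+-identityʳ; *-zeroʳ; *-identityˡ; *-identityʳ)
open import Data.Nat.ListAction using (sum)
open import Data.Product using (_×_; _,_)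
open import Data.Bool using (Bool; true; false; T; T?; if_then_else_; _∧_; _∨_; not)
open import Data.Bool.Properties using (T-irrelevant; ∧-comm)
open import Data.Fin using (Fin; zero; suc; _≟_)
open import Data.Fin.Properties using (suc-injective)
open import Data.List using (map; allFin; tabulate)
open import Data.List.Properties using (map-tabulate)
open import Data.Empty using (⊥-elim)
open import Function using (_∘_)
open import Relation.Binary.Definitions using (DecidableEquality)
open import Relation.Binary.PropositionalEquality
open import Relation.Nullary.Decidable using (yes; no; ⌊_⌋)

𝟙 : Bool → ℕ
𝟙 b = if b then 1 else 0

𝟙-xor-split : ∀ x y → 𝟙 (not (x ∧ y) ∧ (x ∨ y)) ≡ 𝟙 (x ∧ not y) + 𝟙 (y ∧ not x)
𝟙-xor-split true  true  = refl
𝟙-xor-split true  false = refl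
𝟙-xor-split false true  = refl
𝟙-xor-split false false = refl

module _ {a} {A : Set a} (_≟ᴬ_ : DecidableEquality A) where

  ⌊≟⌋-refl : ∀ x → ⌊ x ≟ᴬ x ⌋ ≡ true
  ⌊≟⌋-refl x = cong ⌊_⌋ (≡-≟-identity _≟ᴬ_ refl)

  ⌊≟⌋-sym : ∀ x y → ⌊ x ≟ᴬ y ⌋ ≡ ⌊ y ≟ᴬ x ⌋
  ⌊≟⌋-sym x y with x ≟ᴬ y
  ... | yes refl = sym (⌊≟⌋-refl x)
  ... | no x≢y   = sym (cong ⌊_⌋ (≢-≟-identity _≟ᴬ_ (x≢y ∘ sym)))

sum-tabulate-zero : ∀ {n} (F : Fin n → ℕ) → (∀ i → F i ≡ 0) → sum (tabulate F) ≡ 0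
sum-tabulate-zero {zero}  F F≡0 = refl
sum-tabulate-zero {suc n} F F≡0
  rewrite F≡0 zero | sum-tabulate-zero (F ∘ suc) (F≡0 ∘ suc) = refl

sum-tabulate-δ : ∀ {n} (F : Fin n → ℕ) i → (∀ j → j ≢ i → F j ≡ 0) → sum (tabulate F) ≡ F i
sum-tabulate-δ {suc n} F zero F≡0
  rewrite sum-tabulate-zero (F ∘ suc) (λ j → F≡0 (suc j) λ ()) = +-identityʳ (F zero)
sum-tabulate-δ {suc n} F (suc i) F≡0
  rewrite F≡0 zero (λ ()) = sum-tabulate-δ (F ∘ suc) i (λ j j≢i → F≡0 (suc j) (j≢i ∘ suc-injective))

sum-map-allFin : ∀ {n} (F : Fin n → ℕ) → sum (map F (allFin n)) ≡ sum (tabulate F)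
sum-map-allFin F = cong sum (map-tabulate (λ i → i) F)

module _ {n : ℕ} (G : SimpleGraph n) where

  dedge-≡ : ∀ {c e : DEdge G} → tail c ≡ tail e → head c ≡ head e → c ≡ e
  dedge-≡ {dedge u v p} {dedge u v q} refl refl = cong (dedge u v) (T-irrelevant p q)

  -- The summand of sumDE is a function local to its where-block; unification
  -- names it here.
  mutual
    private
      cell : (DEdge G → ℕ) → Fin n → Fin n → ℕ
      cell = _

      sumDE-by-cells : ∀ f → sumDE G f ≡ sum (map (λ u → sum (map (cell f u) (allFin n))) (allFin n))
      sumDE-by-cells f = refl

  private
    cell-edge : ∀ f (c : DEdge G) → cell f (tail c) (head c) ≡ f c
    cell-edge f c with T? (adj G (tail c) (head c))
    ... | yes p = cong (f ∘ dedge (tail c) (head c)) (T-irrelevant p (isEdge c))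
    ... | no ¬p = ⊥-elim (¬p (isEdge c))

    cell-zero : ∀ f u v → (∀ p → f (dedge u v p) ≡ 0) → cell f u v ≡ 0
    cell-zero f u v f≡0 with T? (adj G u v)
    ... | yes p = f≡0 p
    ... | no _  = refl

  sumDE-δ : ∀ f (e : DEdge G) → (∀ c → c ≢ e → f c ≡ 0) → sumDE G f ≡ f e
  sumDE-δ f e f≡0 = begin
    sumDE G f                                   ≡⟨ sumDE-by-cells f ⟩
    sum (map row (allFin n))                    ≡⟨ sum-map-allFin row ⟩
    sum (tabulate row)                          ≡⟨ sum-tabulate-δ row (tail e) other-row ⟩
    sum (map (cell f (tail e)) (allFin n))      ≡⟨ sum-map-allFin (cell f (tail e)) ⟩
    sum (tabulate (cell f (tail e)))            ≡⟨ sum-tabulate-δ (cell f (tail e)) (head e) other-column ⟩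
    cell f (tail e) (head e)                    ≡⟨ cell-edge f e ⟩
    f e                                         ∎
    where
    open ≡-Reasoning
    row : Fin n → ℕ
    row u = sum (map (cell f u) (allFin n))

    other-row : ∀ u → u ≢ tail e → row u ≡ 0
    other-row u u≢ = trans (sum-map-allFin (cell f u)) (sum-tabulate-zero (cell f u) λ v →
      cell-zero f u v λ p → f≡0 (dedge u v p) (u≢ ∘ cong tail))

    other-column : ∀ v → v ≢ head e → cell f (tail e) v ≡ 0
    other-column v v≢ = cell-zero f (tail e) v λ p → f≡0 (dedge (tail e) v p) (v≢ ∘ cong head)

  reverse : DEdge G → DEdge G
  reverse e = dedge (head e) (tail e) (subst T (adj-sym G (tail e) (head e)) (isEdge e))

  reverse-involutive : ∀ e → reverse (reverse e) ≡ e
  reverse-involutive e = dedge-≡ refl refl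

  reversal-sym : ∀ e f → reversal G e f ≡ reversal G f e
  reversal-sym e f rewrite ⌊≟⌋-sym _≟_ (tail e) (head f) | ⌊≟⌋-sym _≟_ (head e) (tail f) =
    cong 𝟙 (∧-comm ⌊ head f ≟ tail e ⌋ ⌊ tail f ≟ head e ⌋)

  reversal-reverse : ∀ e → reversal G e (reverse e) ≡ 1
  reversal-reverse e rewrite ⌊≟⌋-refl _≟_ (tail e) | ⌊≟⌋-refl _≟_ (head e) = refl

  reversal-≢ : ∀ e c → c ≢ reverse e → reversal G e c ≡ 0
  reversal-≢ e c c≢ with tail e ≟ head c | head e ≟ tail c
  ... | yes t | yes h = ⊥-elim (c≢ (dedge-≡ (sym h) (sym t)))
  ... | yes _ | no _  = refl
  ... | no _  | _     = refl

  reversal-⊗ : ∀ M e f → _⊗_ G (reversal G) M e f ≡ M (reverse e) f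
  reversal-⊗ M e f = begin
    sumDE G (λ c → reversal G e c * M c f)    ≡⟨ sumDE-δ _ (reverse e) (λ c c≢ → cong (_* M c f) (reversal-≢ e c c≢)) ⟩
    reversal G e (reverse e) * M (reverse e) f ≡⟨ cong (_* M (reverse e) f) (reversal-reverse e) ⟩
    1 * M (reverse e) f                        ≡⟨ *-identityˡ _ ⟩
    M (reverse e) f                            ∎
    where open ≡-Reasoning

  ⊗-reversal : ∀ M e f → _⊗_ G M (reversal G) e f ≡ M e (reverse f)
  ⊗-reversal M e f = begin
    sumDE G (λ c → M e c * reversal G c f)    ≡⟨ sumDE-δ _ (reverse f) (λ c c≢ → trans (cong (M e c *_) (reversal-≢′ c c≢)) (*-zeroʳ (M e c))) ⟩
    M e (reverse f) * reversal G (reverse f) f ≡⟨ cong (M e (reverse f) *_) (trans (reversal-sym (reverse f) f) (reversal-reverse f)) ⟩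
    M e (reverse f) * 1                        ≡⟨ *-identityʳ _ ⟩
    M e (reverse f)                            ∎
    where
    open ≡-Reasoning
    reversal-≢′ : ∀ c → c ≢ reverse f → reversal G c f ≡ 0
    reversal-≢′ c c≢ = trans (reversal-sym c f) (reversal-≢ f c c≢)

  hashimoto-reverse-reverse : ∀ e f → hashimoto G (reverse e) (reverse f) ≡ hashimoto G f e
  hashimoto-reverse-reverse e f
    rewrite ⌊≟⌋-sym _≟_ (tail e) (head f) | ⌊≟⌋-sym _≟_ (tail f) (head e) = refl

  hlAdj≡hashimoto-reverseˡ+reverseʳ : ∀ e f →
    hlAdj G e f ≡ hashimoto G (reverse e) f + hashimoto G e (reverse f)
  hlAdj≡hashimoto-reverseˡ+reverseʳ e f
    rewrite ⌊≟⌋-sym _≟_ (head f) (head e) | ⌊≟⌋-sym _≟_ (tail f) (tail e) =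
    𝟙-xor-split ⌊ tail e ≟ tail f ⌋ ⌊ head e ≟ head f ⌋

proposition2p1 : ∀ (n : ℕ) (G : SimpleGraph n) →
    (∀ e f → hlAdj G e f ≡ _⊕_ G (_⊗_ G (reversal G) (hashimoto G)) (_⊗_ G (hashimoto G) (reversal G)) e f)
    × (∀ e f → _⊗_ G (reversal G) (hlAdj G) e f ≡ _⊕_ G (hashimoto G) (transpose G (hashimoto G)) e f)
proposition2p1 n G = A≡PT+TP , PA≡T+Tᵀ
  where
  open ≡-Reasoning
  P T′ A : Mat G
  P = reversal G
  T′ = hashimoto G
  A = hlAdj G

  A≡PT+TP : ∀ e f → A e f ≡ _⊕_ G (_⊗_ G P T′) (_⊗_ G T′ P) e f
  A≡PT+TP e f = begin
    A e f                                       ≡⟨ hlAdj≡hashimoto-reverseˡ+reverseʳ G e f ⟩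
    T′ (reverse G e) f + T′ e (reverse G f)     ≡⟨ sym (cong₂ _+_ (reversal-⊗ G T′ e f) (⊗-reversal G T′ e f)) ⟩
    _⊗_ G P T′ e f + _⊗_ G T′ P e f             ∎

  PA≡T+Tᵀ : ∀ e f → _⊗_ G P A e f ≡ _⊕_ G T′ (transpose G T′) e f
  PA≡T+Tᵀ e f = begin
    _⊗_ G P A e f                                         ≡⟨ reversal-⊗ G A e f ⟩
    A (reverse G e) f                                     ≡⟨ hlAdj≡hashimoto-reverseˡ+reverseʳ G (reverse G e) f ⟩
    T′ (reverse G (reverse G e)) f + T′ (reverse G e) (reverse G f)
      ≡⟨ cong₂ _+_ (cong (λ e′ → T′ e′ f) (reverse-involutive G e)) (hashimoto-reverse-reverse G e f) ⟩
    T′ e f + T′ f e                                       ∎
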